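{- Let $k\ge 1$ and let $\mathcal{C}$ be a collection of non-zero residues modulo $2^{k+1}$ with the property that no sub-collection sums to $2^k$ modulo $2^{k+1}$. Let $T_1(\mathcal{C})$, $T_2(\mathcal{C})$, $T_3(\mathcal{C})$ denote the results of applying a type 1, type 2, type 3 compression to $\mathcal{C}$ respectively (whenever such a compression is possible). Then $T_1(\mathcal{C})^*=\mathcal{C}^*$, $T_2(\mathcal{C})^*\subseteq\mathcal{C}^*$ and $T_3(\mathcal{C})^*\subseteq\mathcal{C}^*$. Moreover, if $T_2(\mathcal{C})$ or $T_3(\mathcal{C})$ contains $m$ disjoint non-empty sub-collections each summing to $0$ modulo $2^{k+1}$, then so does $\mathcal{C}$. Finally, writing $T_1(\mathcal{C},t)$ for the result of a type 1 compression which replaces the element $t$, if $T_1(\mathcal{C},t)$ contains $m+|t|-1$ disjoint non-empty sub-collections each summing to $0$ modulo $2^{k+1}$, then $\mathcal{C}$ contains at least $m$ such sub-collections.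
   Context: A collection is a finite multiset of residues modulo $2^{k+1}$; a sub-collection is a sub-multiset (chosen by a set of positions), and sub-collections are disjoint if they use disjoint sets of positions. For a collection $\mathcal{C}=\{c_1,\dots,c_m\}$, its iterated sumset is the set $\mathcal{C}^*=\{\sum_{i\in I}c_i \bmod 2^{k+1}: I\subseteq\{1,\dots,m\}\}$ (including $0$ from $I=\emptyset$). For a residue $t$ modulo $2^{k+1}$, $|t|$ denotes the minimal absolute value of an integer in the residue class of $t$. Compressions: (Type 1) if $\mathcal{C}$ contains at least $\lambda>0$ elements each equal to $1$ or $-1$, and also an element $t$ with $1<|t|\le\lambda+1$, a type 1 compression replaces $t$ by $|t|$ copies of the residue $1$ if $t\in[1,2^k-1]$ and by $|t|$ copies of $-1$ otherwise. (Type 2) if $\mathcal{C}$ contains an element $-t$ and two copies of $2^k-t$, a type 2 compression replaces the two copies of $2^k-t$ by two copies of $-t$. (Type 3) if $\mathcal{C}$ contains at least $2^{k-1}$ elements each equal to $\pm1$ and two elements $u,v$ whose residues lie in $[(3/2)2^{k-1},2^k-1]$, a type 3 compression replaces $u$ and $v$ by $u-2^k$ and $v-2^k$. -}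

module Defs where

open import Data.Nat using (ℕ; zero; suc; _+_; _*_; _∸_; _^_; _≤_; _<_; _⊓_; _≟_)
open import Data.Nat using (NonZero)
open import Data.Nat.Properties using (m^n≢0)
open import Data.Nat.DivMod using (_%_)
open import Data.List using (List; []; _∷_; _++_; length; filter; replicate)
open import Data.List.Relation.Unary.All using (All)
open import Data.List.Relation.Binary.Permutation.Propositional using (_↭_)
open import Data.Vec using ([]; _∷_)
open import Data.Fin using (Fin)
open import Data.Fin.Subset using (Subset; inside; outside; Nonempty; Empty; _∩_)
open import Data.Product using (Σ; ∃; _×_; _,_)
open import Data.Sum using (_⊎_)
open import Relation.Nullary using (¬_; Dec)
open import Relation.Nullary.Decidable using (_⊎-dec_)
open import Relation.Binary.PropositionalEquality using (_≡_; _≢_)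

-- Modulus 2^(k+1); residues are represented by their canonical
-- representatives in [0, 2^(k+1)).
Mod : ℕ → ℕ
Mod k = 2 ^ suc k


modK : ℕ → ℕ → ℕ
modK k x = _%_ x (Mod k) {{m^n≢0 2 (suc k)}}

-- A collection is a finite multiset of residues, represented as a list
-- (multiset operations are taken up to permutation _↭_).
Collection : Set
Collection = List ℕ

subSum : (C : Collection) → Subset (length C) → ℕ
subSum [] [] = 0
subSum (c ∷ C) (inside ∷ S) = c + subSum C S
subSum (c ∷ C) (outside ∷ S) = subSum C S

InSumset : (k : ℕ) → Collection → ℕ → Set
InSumset k C x = Σ (Subset (length C)) λ S → modK k (subSum C S) ≡ x

-- |t| : minimal absolute value of an integer in the class of t (t < 2^(k+1))
absRes : ℕ → ℕ → ℕ
absRes k t = t ⊓ (Mod k ∸ t)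

IsPM1 : ℕ → ℕ → Set
IsPM1 k c = (c ≡ 1) ⊎ (c ≡ Mod k ∸ 1)

isPM1? : (k c : ℕ) → Dec (IsPM1 k c)
isPM1? k c = (c ≟ 1) ⊎-dec (c ≟ Mod k ∸ 1)

countPM1 : ℕ → Collection → ℕ
countPM1 k C = length (filter (isPM1? k) C)

Type1 : (k : ℕ) → Collection → ℕ → Collection → Set
Type1 k C t C' =
  Σ ℕ λ lam → (0 < lam) × (lam ≤ countPM1 k C) ×
  (1 < absRes k t) × (absRes k t ≤ lam + 1) ×
  Σ Collection λ R → (C ↭ (t ∷ R)) ×
   (((1 ≤ t) × (t ≤ 2 ^ k ∸ 1) × (C' ↭ (replicate (absRes k t) 1 ++ R)))
    ⊎ (¬ ((1 ≤ t) × (t ≤ 2 ^ k ∸ 1)) × (C' ↭ (replicate (absRes k t) (Mod k ∸ 1) ++ R))))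

-- C' is the result of a type 2 compression of C: C contains -t and two
-- copies of 2^k - t; the two copies of 2^k - t are replaced by -t.
Type2 : (k : ℕ) → Collection → Collection → Set
Type2 k C C' =
  Σ ℕ λ t → (t < Mod k) ×
  Σ Collection λ R →
    let a = modK k (Mod k ∸ t)
        b = modK k (2 ^ k + (Mod k ∸ t))
    in (C ↭ (a ∷ b ∷ b ∷ R)) × (C' ↭ (a ∷ a ∷ a ∷ R))

-- C' is the result of a type 3 compression of C: u, v with residues in
-- [(3/2)2^(k-1), 2^k - 1] are replaced by u - 2^k, v - 2^k (i.e. u + 2^k, v + 2^k mod 2^(k+1)).
Type3 : (k : ℕ) → Collection → Collection → Set
Type3 k C C' =
  (2 ^ (k ∸ 1) ≤ countPM1 k C) ×
  Σ ℕ λ u → Σ ℕ λ v →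
  (3 * 2 ^ (k ∸ 1) ≤ 2 * u) × (u ≤ 2 ^ k ∸ 1) ×
  (3 * 2 ^ (k ∸ 1) ≤ 2 * v) × (v ≤ 2 ^ k ∸ 1) ×
  Σ Collection λ R → (C ↭ (u ∷ v ∷ R)) × (C' ↭ ((u + 2 ^ k) ∷ (v + 2 ^ k) ∷ R))

DisjZeroSums : (k : ℕ) → Collection → ℕ → Set
DisjZeroSums k C m =
  Σ (Fin m → Subset (length C)) λ F →
    (∀ i → Nonempty (F i)) ×
    (∀ i → modK k (subSum C (F i)) ≡ 0) ×
    (∀ i j → i ≢ j → Empty (F i ∩ F j))

module Submission where

-- Types 2 and 3 change elements by 2^k only, so a sub-collection of the compressed collection sums,
-- modulo 2^(k+1), to the sum of the same positions of the original or to that plus 2^k.  A zero sum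
-- therefore comes from a zero sum of the original, the alternative 2^k being excluded.  For sumsets the
-- shift by 2^k has to be undone: for type 2 because b + b ≡ a + a, for type 3 with the elements ±1.
-- Toggling the +1's inside a sub-collection and the −1's outside it lowers its sum by any amount up to
-- their number, and the remaining ±1's raise it likewise; as these two rooms add up to the number of
-- ±1's, one of the shifts needed (down by 2^k − u, or up by 2^k − v) is available.  A type 1 compression
-- replaces t by |t| units c = ±1 with |t| c ≡ t, and j of those units are matched either by shifting the
-- rest by j or by t together with a shift by |t| − j.  Among disjoint zero sums of the compressed
-- collection, those meeting the new units are at most |t| in number; if there are |t| of them they use
-- every unit, and their union becomes a single zero-sum sub-collection through t.

open import Defs
open import Data.Nat
  using (ℕ; zero; suc; _+_; _*_; _∸_; _^_; _≤_; _<_; z≤n; s≤s; s≤s⁻¹; NonZero; _≟_; _≤?_)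
open import Data.Nat.Properties
open import Data.Nat.DivMod using (_%_; %-distribˡ-+; [m+kn]%n≡m%n; m%n%n≡m%n; m<n⇒m%n≡m)
open import Data.Nat.Tactic.RingSolver using (solve-∀)
open import Algebra.Properties.CommutativeSemigroup +-commutativeSemigroup using (x∙yz≈y∙xz)
open import Data.List using (List; []; _∷_; _++_; length; replicate; filter; map; lookup; tabulate)
open import Data.List.Properties
  using (filter-accept; filter-reject; length-map; length-tabulate; length-replicate)
open import Data.List.Relation.Unary.All using (All; []; _∷_)
import Data.List.Relation.Unary.All as All
import Data.List.Relation.Unary.All.Properties as All
open import Data.List.Relation.Unary.AllPairs using (AllPairs; []; _∷_)
import Data.List.Relation.Unary.AllPairs as AllPairs
import Data.List.Relation.Unary.AllPairs.Properties as AllPairs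
open import Data.List.Membership.Propositional.Properties using (∈-lookup)
open import Data.List.Relation.Binary.Permutation.Propositional
  using (_↭_; prep; swap; ↭-sym) renaming (refl to ↭-refl; trans to ↭-trans)
open import Data.List.Relation.Binary.Permutation.Propositional.Properties
  using (↭-length; filter-↭; All-resp-↭)
open import Data.Vec using ([]; _∷_; here; there)
open import Data.Vec.Properties using (∷-injective)
open import Data.Fin using (zero; suc; inject≤)
open import Data.Fin.Properties using (inject≤-injective)
open import Data.Fin.Subset
  using (Subset; Side; inside; outside; Nonempty; Empty; _∩_; _∪_; ⊥; ⊤; ∣_∣; ⋃)
open import Data.Fin.Subset.Properties
  using (Empty-unique; ∉⊥; ∣p∣≤n; ∣⊤∣≡n; ∩-comm; ∩-zeroʳ; ∩-distribˡ-∪; ∪-identityʳ)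
open import Data.Product using (Σ; _×_; _,_; proj₁; proj₂)
open import Data.Sum using (_⊎_; inj₁; inj₂)
open import Data.Empty using (⊥-elim)
open import Function using (_∘′_)
open import Function.Bundles using (_⇔_; mk⇔)
open import Relation.Nullary using (¬_; Dec; yes; no)
open import Level using (0ℓ)
open import Relation.Unary using (Pred; Decidable)
open import Relation.Unary.Properties using (∁?)
open import Relation.Binary using (Rel; Symmetric)
open import Relation.Binary.PropositionalEquality

m+n≤o+p⇒m≰o⇒n≤p : ∀ {e f ℓ r} → e + f ≤ ℓ + r → ¬ e ≤ ℓ → f ≤ r
m+n≤o+p⇒m≰o⇒n≤p {e} {f} {ℓ} {r} e+f≤ℓ+r e≰ℓ =
  +-cancelˡ-≤ ℓ f r (≤-trans (+-monoˡ-≤ f (<⇒≤ (≰⇒> e≰ℓ))) e+f≤ℓ+r)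

2*[2P∸u]≤P : ∀ P u → 3 * P ≤ 2 * u → 2 * (2 * P ∸ u) ≤ P
2*[2P∸u]≤P P u 3P≤2u = begin
  2 * (2 * P ∸ u)       ≡⟨ *-distribˡ-∸ 2 (2 * P) u ⟩
  2 * (2 * P) ∸ 2 * u   ≤⟨ ∸-monoʳ-≤ (2 * (2 * P)) 3P≤2u ⟩
  2 * (2 * P) ∸ 3 * P   ≡⟨ cong (_∸ 3 * P) (shuffle P) ⟩
  P + 3 * P ∸ 3 * P     ≡⟨ m+n∸n≡m P (3 * P) ⟩
  P                     ∎
  where
  open ≤-Reasoning
  shuffle : ∀ P → 2 * (2 * P) ≡ P + 3 * P
  shuffle = solve-∀

m≤1+n+o⇒p≰o⇒m∸p≤n : ∀ {a j ℓ r} → a ≤ suc (ℓ + r) → ¬ j ≤ r → a ∸ j ≤ ℓ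
m≤1+n+o⇒p≰o⇒m∸p≤n {a} {j} {ℓ} {r} a≤1+ℓ+r j≰r = begin
  a ∸ j             ≤⟨ ∸-monoˡ-≤ j a≤1+ℓ+r ⟩
  suc (ℓ + r) ∸ j   ≡⟨ cong (_∸ j) (sym (+-suc ℓ r)) ⟩
  ℓ + suc r ∸ j     ≤⟨ ∸-monoʳ-≤ (ℓ + suc r) (≰⇒> j≰r) ⟩
  ℓ + suc r ∸ suc r ≡⟨ m+n∸n≡m ℓ (suc r) ⟩
  ℓ                 ∎
  where open ≤-Reasoning

m+n≤o+p⇒p≤n⇒m≤o : ∀ {m n o p} → m + n ≤ o + p → p ≤ n → m ≤ o
m+n≤o+p⇒p≤n⇒m≤o {m} {n} {o} m+n≤o+p p≤n =
  +-cancelʳ-≤ n m o (≤-trans m+n≤o+p (+-monoʳ-≤ o p≤n))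

Disjoint : ∀ {n} → Subset n → Subset n → Set
Disjoint S T = S ∩ T ≡ ⊥

Nonempty⇒≢⊥ : ∀ {n} {S : Subset n} → Nonempty S → S ≢ ⊥
Nonempty⇒≢⊥ (x , x∈S) refl = ∉⊥ x∈S

≢⊥⇒Nonempty : ∀ {n} (S : Subset n) → S ≢ ⊥ → Nonempty S
≢⊥⇒Nonempty [] S≢⊥ = ⊥-elim (S≢⊥ refl)
≢⊥⇒Nonempty (inside ∷ S) _ = zero , here
≢⊥⇒Nonempty (outside ∷ S) S≢⊥ with ≢⊥⇒Nonempty S (S≢⊥ ∘′ cong (outside ∷_))
... | x , x∈S = suc x , there x∈S

≡⊥⇒Empty : ∀ {n} {S : Subset n} → S ≡ ⊥ → Empty S
≡⊥⇒Empty refl (x , x∈⊥) = ∉⊥ x∈⊥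

Disjoint-sym : ∀ {n} → Symmetric (Disjoint {n})
Disjoint-sym {x = S} {T} S∩T≡⊥ = trans (∩-comm T S) S∩T≡⊥

Disjoint-⋃ : ∀ {n} {S : Subset n} {Ts : List (Subset n)} → All (Disjoint S) Ts → Disjoint S (⋃ Ts)
Disjoint-⋃ {S = S} [] = ∩-zeroʳ S
Disjoint-⋃ {S = S} {T ∷ Ts} (S∩T≡⊥ ∷ disjoint) = begin
  S ∩ (T ∪ ⋃ Ts)        ≡⟨ ∩-distribˡ-∪ S T (⋃ Ts) ⟩
  S ∩ T ∪ S ∩ ⋃ Ts      ≡⟨ cong₂ _∪_ S∩T≡⊥ (Disjoint-⋃ disjoint) ⟩
  ⊥ ∪ ⊥                 ≡⟨ ∪-identityʳ ⊥ ⟩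
  ⊥                     ∎
  where open ≡-Reasoning

∣∪∣≡∣∣+∣∣ : ∀ {n} (S T : Subset n) → Disjoint S T → ∣ S ∪ T ∣ ≡ ∣ S ∣ + ∣ T ∣
∣∪∣≡∣∣+∣∣ [] [] _ = refl
∣∪∣≡∣∣+∣∣ (inside ∷ S) (inside ∷ T) ()
∣∪∣≡∣∣+∣∣ (inside ∷ S) (outside ∷ T) S∩T≡⊥ =
  cong suc (∣∪∣≡∣∣+∣∣ S T (proj₂ (∷-injective S∩T≡⊥)))
∣∪∣≡∣∣+∣∣ (outside ∷ S) (inside ∷ T) S∩T≡⊥ =
  trans (cong suc (∣∪∣≡∣∣+∣∣ S T (proj₂ (∷-injective S∩T≡⊥)))) (sym (+-suc _ _))
∣∪∣≡∣∣+∣∣ (outside ∷ S) (outside ∷ T) S∩T≡⊥ =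
  ∣∪∣≡∣∣+∣∣ S T (proj₂ (∷-injective S∩T≡⊥))

∣S∣≡0⇒S≡⊥ : ∀ {n} (S : Subset n) → ∣ S ∣ ≡ 0 → S ≡ ⊥
∣S∣≡0⇒S≡⊥ [] _ = refl
∣S∣≡0⇒S≡⊥ (outside ∷ S) ∣S∣≡0 = cong (outside ∷_) (∣S∣≡0⇒S≡⊥ S ∣S∣≡0)

module _ {A : Set} {P : Pred A 0ℓ} (P? : Decidable P) where

  length-filter+length-filter-∁ : ∀ xs → length (filter P? xs) + length (filter (∁? P?) xs) ≡ length xs
  length-filter+length-filter-∁ [] = refl
  length-filter+length-filter-∁ (x ∷ xs) with P? x
  ... | yes _ = cong suc (length-filter+length-filter-∁ xs)
  ... | no _ = trans (+-suc _ _) (cong suc (length-filter+length-filter-∁ xs))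

  AllPairs-filter-∁ : ∀ {R : Rel A 0ℓ} → Symmetric R → ∀ {xs} → AllPairs R xs →
                      All (λ x → All (R x) (filter (∁? P?) xs)) (filter P? xs)
  AllPairs-filter-∁ R-sym {[]} [] = []
  AllPairs-filter-∁ R-sym {x ∷ xs} (Rx ∷ pairs) with P? x
  ... | yes _ = All.filter⁺ (∁? P?) Rx ∷ AllPairs-filter-∁ R-sym pairs
  ... | no _ =
    All.zipWith (λ (Rxy , Rys) → R-sym Rxy ∷ Rys) (All.filter⁺ P? Rx , AllPairs-filter-∁ R-sym pairs)

AllPairs-lookup : ∀ {A : Set} {R : Rel A 0ℓ} → Symmetric R → ∀ {xs} → AllPairs R xs →
                  ∀ i j → i ≢ j → R (lookup xs i) (lookup xs j)
AllPairs-lookup R-sym (Rx ∷ pairs) zero zero i≢j = ⊥-elim (i≢j refl)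
AllPairs-lookup R-sym (Rx ∷ pairs) zero (suc j) _ = All.lookup Rx (∈-lookup j)
AllPairs-lookup R-sym (Rx ∷ pairs) (suc i) zero _ = R-sym (All.lookup Rx (∈-lookup i))
AllPairs-lookup R-sym (Rx ∷ pairs) (suc i) (suc j) i≢j =
  AllPairs-lookup R-sym pairs i j (i≢j ∘′ cong suc)

subSum-⊥ : ∀ (C : Collection) → subSum C ⊥ ≡ 0
subSum-⊥ [] = refl
subSum-⊥ (c ∷ C) = subSum-⊥ C

subSum-∪ : ∀ (C : Collection) (S T : Subset (length C)) → Disjoint S T →
           subSum C (S ∪ T) ≡ subSum C S + subSum C T
subSum-∪ [] [] [] _ = refl
subSum-∪ (c ∷ C) (inside ∷ S) (inside ∷ T) ()
subSum-∪ (c ∷ C) (inside ∷ S) (outside ∷ T) S∩T≡⊥ =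
  trans (cong (c +_) (subSum-∪ C S T (proj₂ (∷-injective S∩T≡⊥)))) (sym (+-assoc c _ _))
subSum-∪ (c ∷ C) (outside ∷ S) (inside ∷ T) S∩T≡⊥ =
  trans (cong (c +_) (subSum-∪ C S T (proj₂ (∷-injective S∩T≡⊥))))
        (x∙yz≈y∙xz c (subSum C S) (subSum C T))
subSum-∪ (c ∷ C) (outside ∷ S) (outside ∷ T) S∩T≡⊥ =
  subSum-∪ C S T (proj₂ (∷-injective S∩T≡⊥))

subSum-replicate : ∀ a c (S : Subset (length (replicate a c))) → subSum (replicate a c) S ≡ ∣ S ∣ * c
subSum-replicate zero c [] = refl
subSum-replicate (suc a) c (inside ∷ S) = cong (c +_) (subSum-replicate a c S)
subSum-replicate (suc a) c (outside ∷ S) = subSum-replicate a c S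

module _ {R : Collection} where

  prefix : (xs : Collection) → Subset (length (xs ++ R)) → Subset (length xs)
  prefix [] S = []
  prefix (x ∷ xs) (s ∷ S) = s ∷ prefix xs S

  suffix : (xs : Collection) → Subset (length (xs ++ R)) → Subset (length R)
  suffix [] S = S
  suffix (x ∷ xs) (s ∷ S) = suffix xs S

  append : (xs : Collection) → Subset (length xs) → Subset (length R) → Subset (length (xs ++ R))
  append [] [] T = T
  append (x ∷ xs) (s ∷ S) T = s ∷ append xs S T

  append-prefix-suffix : ∀ xs S → append xs (prefix xs S) (suffix xs S) ≡ S
  append-prefix-suffix [] S = refl
  append-prefix-suffix (x ∷ xs) (s ∷ S) = cong (s ∷_) (append-prefix-suffix xs S)

  subSum-append : ∀ xs S T → subSum (xs ++ R) (append xs S T) ≡ subSum xs S + subSum R T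
  subSum-append [] [] T = refl
  subSum-append (x ∷ xs) (inside ∷ S) T = trans (cong (x +_) (subSum-append xs S T)) (sym (+-assoc x _ _))
  subSum-append (x ∷ xs) (outside ∷ S) T = subSum-append xs S T

  subSum-++ : ∀ xs S → subSum (xs ++ R) S ≡ subSum xs (prefix xs S) + subSum R (suffix xs S)
  subSum-++ xs S = trans (cong (subSum (xs ++ R)) (sym (append-prefix-suffix xs S))) (subSum-append xs _ _)

  prefix-Disjoint : ∀ xs {S T} → Disjoint S T → Disjoint (prefix xs S) (prefix xs T)
  prefix-Disjoint [] _ = refl
  prefix-Disjoint (x ∷ xs) {s ∷ S} {t ∷ T} S∩T≡⊥ with ∷-injective S∩T≡⊥
  ... | s∧t≡outside , S∩T≡⊥′ = cong₂ _∷_ s∧t≡outside (prefix-Disjoint xs S∩T≡⊥′)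

  suffix-Disjoint : ∀ xs {S T} → Disjoint S T → Disjoint (suffix xs S) (suffix xs T)
  suffix-Disjoint [] S∩T≡⊥ = S∩T≡⊥
  suffix-Disjoint (x ∷ xs) {s ∷ S} {t ∷ T} S∩T≡⊥ =
    suffix-Disjoint xs (proj₂ (∷-injective S∩T≡⊥))

  prefix-∪ : ∀ xs S T → prefix xs (S ∪ T) ≡ prefix xs S ∪ prefix xs T
  prefix-∪ [] S T = refl
  prefix-∪ (x ∷ xs) (s ∷ S) (t ∷ T) = cong (_ ∷_) (prefix-∪ xs S T)

  append-⊥ : ∀ xs → append xs ⊥ ⊥ ≡ ⊥
  append-⊥ [] = refl
  append-⊥ (x ∷ xs) = cong (outside ∷_) (append-⊥ xs)

reindex : {A B : Collection} → A ↭ B → Subset (length A) → Subset (length B)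
reindex ↭-refl S = S
reindex (prep x p) (s ∷ S) = s ∷ reindex p S
reindex (swap x y p) (s ∷ s′ ∷ S) = s′ ∷ s ∷ reindex p S
reindex (↭-trans p q) S = reindex q (reindex p S)

subSum-reindex : {A B : Collection} (p : A ↭ B) (S : Subset (length A)) →
                 subSum B (reindex p S) ≡ subSum A S
subSum-reindex ↭-refl S = refl
subSum-reindex (prep x p) (inside ∷ S) = cong (x +_) (subSum-reindex p S)
subSum-reindex (prep x p) (outside ∷ S) = subSum-reindex p S
subSum-reindex (swap x y p) (inside ∷ inside ∷ S) =
  trans (cong (λ z → y + (x + z)) (subSum-reindex p S)) (x∙yz≈y∙xz y x _)
subSum-reindex (swap x y p) (inside ∷ outside ∷ S) = cong (x +_) (subSum-reindex p S)
subSum-reindex (swap x y p) (outside ∷ inside ∷ S) = cong (y +_) (subSum-reindex p S)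
subSum-reindex (swap x y p) (outside ∷ outside ∷ S) = subSum-reindex p S
subSum-reindex (↭-trans p q) S = trans (subSum-reindex q (reindex p S)) (subSum-reindex p S)

reindex-Disjoint : {A B : Collection} (p : A ↭ B) {S T : Subset (length A)} →
                   Disjoint S T → Disjoint (reindex p S) (reindex p T)
reindex-Disjoint ↭-refl S∩T≡⊥ = S∩T≡⊥
reindex-Disjoint (prep x p) {s ∷ S} {t ∷ T} S∩T≡⊥ with ∷-injective S∩T≡⊥
... | s∧t≡outside , S∩T≡⊥′ = cong₂ _∷_ s∧t≡outside (reindex-Disjoint p S∩T≡⊥′)
reindex-Disjoint (swap x y p) {s ∷ s′ ∷ S} {t ∷ t′ ∷ T} S∩T≡⊥ with ∷-injective S∩T≡⊥
... | s∧t≡outside , S∩T≡⊥′ with ∷-injective S∩T≡⊥′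
... | s′∧t′≡outside , S∩T≡⊥″ =
  cong₂ _∷_ s′∧t′≡outside (cong₂ _∷_ s∧t≡outside (reindex-Disjoint p S∩T≡⊥″))
reindex-Disjoint (↭-trans p q) S∩T≡⊥ = reindex-Disjoint q (reindex-Disjoint p S∩T≡⊥)

reindex-≡⊥ : {A B : Collection} (p : A ↭ B) (S : Subset (length A)) → reindex p S ≡ ⊥ → S ≡ ⊥
reindex-≡⊥ ↭-refl S eq = eq
reindex-≡⊥ (prep x p) (s ∷ S) eq with ∷-injective eq
... | refl , eq′ = cong (outside ∷_) (reindex-≡⊥ p S eq′)
reindex-≡⊥ (swap x y p) (s ∷ s′ ∷ S) eq with ∷-injective eq
... | refl , eq′ with ∷-injective eq′
... | refl , eq″ = cong (λ z → outside ∷ outside ∷ z) (reindex-≡⊥ p S eq″)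
reindex-≡⊥ (↭-trans p q) S eq = reindex-≡⊥ p S (reindex-≡⊥ q (reindex p S) eq)

HalfFree : ℕ → Collection → Set
HalfFree k C = ∀ (S : Subset (length C)) → modK k (subSum C S) ≢ 2 ^ k

module _ (k : ℕ) {A B : Collection} (p : A ↭ B) where

  InSumset-resp-↭ : ∀ {x} → InSumset k A x → InSumset k B x
  InSumset-resp-↭ (S , eq) = reindex p S , trans (cong (modK k) (subSum-reindex p S)) eq

  HalfFree-resp-↭ : HalfFree k A → HalfFree k B
  HalfFree-resp-↭ halfFree S eq =
    halfFree (reindex (↭-sym p) S) (trans (cong (modK k) (subSum-reindex (↭-sym p) S)) eq)

  DisjZeroSums-resp-↭ : ∀ {m} → DisjZeroSums k A m → DisjZeroSums k B m
  DisjZeroSums-resp-↭ (F , nonempty , zero-sum , disjoint) =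
    (λ i → reindex p (F i)) ,
    (λ i → ≢⊥⇒Nonempty _ (Nonempty⇒≢⊥ (nonempty i) ∘′ reindex-≡⊥ p (F i))) ,
    (λ i → trans (cong (modK k) (subSum-reindex p (F i))) (zero-sum i)) ,
    (λ i j i≢j → ≡⊥⇒Empty (reindex-Disjoint p (Empty-unique (disjoint i j i≢j))))

module Congruence (k : ℕ) where

  instance
    Mod≢0 : NonZero (Mod k)
    Mod≢0 = m^n≢0 2 (suc k)

  H : ℕ
  H = 2 ^ k

  Mod≡H+H : Mod k ≡ H + H
  Mod≡H+H = cong (H +_) (+-identityʳ H)

  0<H : 0 < H
  0<H = m^n>0 2 k

  0<Mod : 0 < Mod k
  0<Mod = m^n>0 2 (suc k)

  H<Mod : H < Mod k
  H<Mod = subst (H <_) (sym Mod≡H+H) (m<m+n H 0<H)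

  infix 4 _≈_
  _≈_ : ℕ → ℕ → Set
  x ≈ y = modK k x ≡ modK k y

  ≡⇒≈ : ∀ {x y} → x ≡ y → x ≈ y
  ≡⇒≈ = cong (modK k)

  ≈-+ : ∀ {a b c d} → a ≈ b → c ≈ d → a + c ≈ b + d
  ≈-+ {a} {b} {c} {d} a≈b c≈d = begin
    (a + c) % Mod k                 ≡⟨ %-distribˡ-+ a c (Mod k) ⟩
    (a % Mod k + c % Mod k) % Mod k ≡⟨ cong₂ (λ x y → (x + y) % Mod k) a≈b c≈d ⟩
    (b % Mod k + d % Mod k) % Mod k ≡⟨ %-distribˡ-+ b d (Mod k) ⟨
    (b + d) % Mod k                 ∎
    where open ≡-Reasoning

  ≈-+ˡ : ∀ a {c d} → c ≈ d → a + c ≈ a + d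
  ≈-+ˡ a = ≈-+ {a} refl

  ≈-+ʳ : ∀ {a b} c → a ≈ b → a + c ≈ b + c
  ≈-+ʳ c a≈b = ≈-+ a≈b (refl {x = modK k c})

  +*Mod≈ : ∀ a n → a + n * Mod k ≈ a
  +*Mod≈ a n = [m+kn]%n≡m%n a n (Mod k)

  +Mod≈ : ∀ a → a + Mod k ≈ a
  +Mod≈ a = trans (≡⇒≈ (cong (a +_) (sym (*-identityˡ (Mod k))))) (+*Mod≈ a 1)

  +H+H≈ : ∀ a → a + H + H ≈ a
  +H+H≈ a = trans (≡⇒≈ (trans (+-assoc a H H) (cong (a +_) (sym Mod≡H+H)))) (+Mod≈ a)

  *[Mod∸1]+≡*Mod : ∀ n → n * (Mod k ∸ 1) + n ≡ n * Mod k
  *[Mod∸1]+≡*Mod n = begin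
    n * (Mod k ∸ 1) + n       ≡⟨ cong (n * (Mod k ∸ 1) +_) (*-identityʳ n) ⟨
    n * (Mod k ∸ 1) + n * 1   ≡⟨ *-distribˡ-+ n (Mod k ∸ 1) 1 ⟨
    n * (Mod k ∸ 1 + 1)       ≡⟨ cong (n *_) (m∸n+n≡m 0<Mod) ⟩
    n * Mod k                 ∎
    where open ≡-Reasoning

  modK≈ : ∀ x → modK k x ≈ x
  modK≈ x = m%n%n≡m%n x (Mod k)

  modK-small : ∀ {x} → x < Mod k → modK k x ≡ x
  modK-small x<Mod = m<n⇒m%n≡m x<Mod

  modK-0 : modK k 0 ≡ 0
  modK-0 = modK-small 0<Mod

  -- Mod k ∸ 1 is the residue −1.
  ∸1+suc≈ : ∀ x d → (Mod k ∸ 1) + x + suc d ≈ x + d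
  ∸1+suc≈ x d = trans (≡⇒≈ (begin
    (Mod k ∸ 1) + x + suc d   ≡⟨ shuffle (Mod k ∸ 1) x d ⟩
    x + d + suc (Mod k ∸ 1)   ≡⟨ cong (x + d +_) (m+[n∸m]≡n 0<Mod) ⟩
    x + d + Mod k             ∎)) (+Mod≈ (x + d))
    where
    open ≡-Reasoning
    shuffle : ∀ m x d → m + x + suc d ≡ x + d + suc m
    shuffle = solve-∀

  HalfShift : ℕ → ℕ → Set
  HalfShift y x = y ≈ x ⊎ y ≈ x + H

  HalfShift-+ : ∀ {y x y′ x′} → HalfShift y x → HalfShift y′ x′ → HalfShift (y + y′) (x + x′)
  HalfShift-+ (inj₁ y≈x) (inj₁ y′≈x′) = inj₁ (≈-+ y≈x y′≈x′)
  HalfShift-+ {x = x} {x′ = x′} (inj₁ y≈x) (inj₂ y′≈x′+H) =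
    inj₂ (trans (≈-+ y≈x y′≈x′+H) (≡⇒≈ (sym (+-assoc x x′ H))))
  HalfShift-+ {x = x} {x′ = x′} (inj₂ y≈x+H) (inj₁ y′≈x′) =
    inj₂ (trans (≈-+ y≈x+H y′≈x′) (≡⇒≈ (shuffle x H x′)))
    where
    shuffle : ∀ x h x′ → x + h + x′ ≡ x + x′ + h
    shuffle = solve-∀
  HalfShift-+ {x = x} {x′ = x′} (inj₂ y≈x+H) (inj₂ y′≈x′+H) =
    inj₁ (trans (≈-+ y≈x+H y′≈x′+H) (trans (≡⇒≈ (shuffle x H x′)) (+H+H≈ (x + x′))))
    where
    shuffle : ∀ x h x′ → x + h + (x′ + h) ≡ x + x′ + h + h
    shuffle = solve-∀

  HalfShift-zero : ∀ {y x} → HalfShift y x → modK k y ≢ H → modK k x ≡ 0 → modK k y ≡ 0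
  HalfShift-zero (inj₁ y≈x) _ x≡0 = trans y≈x x≡0
  HalfShift-zero {x = x} (inj₂ y≈x+H) y≢H x≡0 = ⊥-elim (y≢H (begin
    modK k _              ≡⟨ y≈x+H ⟩
    modK k (x + H)        ≡⟨ ≈-+ʳ H (sym (modK≈ x)) ⟩
    modK k (modK k x + H) ≡⟨ cong (λ r → modK k (r + H)) x≡0 ⟩
    modK k H              ≡⟨ modK-small H<Mod ⟩
    H                     ∎))
    where open ≡-Reasoning

  HalfShift-∷ : ∀ {y x} {B A : Collection} s {S : Subset (length B)} {S′ : Subset (length A)} →
                HalfShift y x → HalfShift (subSum B S) (subSum A S′) →
                HalfShift (subSum (y ∷ B) (s ∷ S)) (subSum (x ∷ A) (s ∷ S′))
  HalfShift-∷ inside  = HalfShift-+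
  HalfShift-∷ outside _ shift = shift

module _ (k : ℕ) {C C′ A A′ : Collection} (p : C ↭ A) (q : C′ ↭ A′) where
  open Congruence k

  InSumset-⊆ : (∀ (S : Subset (length A′)) → Σ (Subset (length A)) λ S′ → subSum A S′ ≈ subSum A′ S) →
               ∀ {x} → InSumset k C′ x → InSumset k C x
  InSumset-⊆ cover s with InSumset-resp-↭ k q s
  ... | S , eq with cover S
  ... | S′ , eq′ = InSumset-resp-↭ k (↭-sym p) (S′ , trans eq′ eq)

-- DisjZeroSums as a list, so that the family can be partitioned.
ZeroSum : ℕ → (C : Collection) → Subset (length C) → Set
ZeroSum k C S = S ≢ ⊥ × modK k (subSum C S) ≡ 0

Packing : ℕ → (C : Collection) → List (Subset (length C)) → Set
Packing k C L = All (ZeroSum k C) L × AllPairs Disjoint L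

module _ {k : ℕ} {C : Collection} where
  open Congruence k

  DisjZeroSums⇒Packing : ∀ {m} → DisjZeroSums k C m →
                         Σ (List (Subset (length C))) λ L → length L ≡ m × Packing k C L
  DisjZeroSums⇒Packing (F , nonempty , zero-sum , disjoint) =
    tabulate F , length-tabulate F ,
    All.tabulate⁺ (λ i → Nonempty⇒≢⊥ (nonempty i) , zero-sum i) ,
    AllPairs.tabulate⁺ (λ {i} {j} i≢j → Empty-unique (disjoint i j i≢j))

  Packing⇒DisjZeroSums : ∀ {m L} → m ≤ length L → Packing k C L → DisjZeroSums k C m
  Packing⇒DisjZeroSums {L = L} m≤∣L∣ (zero-sums , pairs) =
    (λ i → lookup L (index i)) ,
    (λ i → ≢⊥⇒Nonempty _ (proj₁ (zeroSum i))) ,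
    (λ i → proj₂ (zeroSum i)) ,
    (λ i j i≢j → ≡⊥⇒Empty (AllPairs-lookup Disjoint-sym pairs (index i) (index j)
                             (i≢j ∘′ inject≤-injective m≤∣L∣ m≤∣L∣ i j)))
    where
    index = λ i → inject≤ i m≤∣L∣
    zeroSum = λ i → All.lookup zero-sums (∈-lookup (index i))

  modK-subSum-⋃ : ∀ {Ts} → AllPairs Disjoint Ts → All (ZeroSum k C) Ts → modK k (subSum C (⋃ Ts)) ≡ 0
  modK-subSum-⋃ {[]} _ _ = trans (cong (modK k) (subSum-⊥ C)) modK-0
  modK-subSum-⋃ {T ∷ Ts} (disjoint ∷ pairs) ((_ , T≡0) ∷ zero-sums) = begin
    modK k (subSum C (T ∪ ⋃ Ts))            ≡⟨ ≡⇒≈ (subSum-∪ C T (⋃ Ts) (Disjoint-⋃ disjoint)) ⟩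
    modK k (subSum C T + subSum C (⋃ Ts))   ≡⟨ ≈-+ (≡0⇒≈0 T≡0)
                                                   (≡0⇒≈0 (modK-subSum-⋃ pairs zero-sums)) ⟩
    modK k 0                                ≡⟨ modK-0 ⟩
    0                                       ∎
    where
    open ≡-Reasoning
    ≡0⇒≈0 : ∀ {x} → modK k x ≡ 0 → x ≈ 0
    ≡0⇒≈0 x≡0 = trans x≡0 (sym modK-0)

module Rooms (k : ℕ) where
  open Congruence k

  countPM1-↭ : ∀ {A B : Collection} → A ↭ B → countPM1 k A ≡ countPM1 k B
  countPM1-↭ p = ↭-length (filter-↭ (isPM1? k) p)

  countPM1-accept : ∀ {c} R → IsPM1 k c → countPM1 k (c ∷ R) ≡ suc (countPM1 k R)
  countPM1-accept R pm1 = cong length (filter-accept (isPM1? k) pm1)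

  countPM1-reject : ∀ {c} R → ¬ IsPM1 k c → countPM1 k (c ∷ R) ≡ countPM1 k R
  countPM1-reject R ¬pm1 = cong length (filter-reject (isPM1? k) ¬pm1)

  -- Toggling a +1 inside S, or a −1 outside S, lowers the sum of S by one;
  -- toggling a +1 outside or a −1 inside raises it by one.
  lowerStep raiseStep : ∀ {c} → Dec (IsPM1 k c) → Side → ℕ
  lowerStep (yes (inj₁ _)) inside  = 1
  lowerStep (yes (inj₂ _)) outside = 1
  lowerStep _              _       = 0
  raiseStep (yes (inj₁ _)) outside = 1
  raiseStep (yes (inj₂ _)) inside  = 1
  raiseStep _              _       = 0

  lowerRoom raiseRoom : (R : Collection) → Subset (length R) → ℕ
  lowerRoom [] [] = 0
  lowerRoom (c ∷ R) (s ∷ S) = lowerStep (isPM1? k c) s + lowerRoom R S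
  raiseRoom [] [] = 0
  raiseRoom (c ∷ R) (s ∷ S) = raiseStep (isPM1? k c) s + raiseRoom R S

  lowerRoom+raiseRoom≡countPM1 : ∀ R (S : Subset (length R)) →
                                 lowerRoom R S + raiseRoom R S ≡ countPM1 k R
  lowerRoom+raiseRoom≡countPM1 [] [] = refl
  lowerRoom+raiseRoom≡countPM1 (c ∷ R) (s ∷ S) with isPM1? k c | s
  ... | yes pm1@(inj₁ _) | inside  =
    trans (cong suc (lowerRoom+raiseRoom≡countPM1 R S)) (sym (countPM1-accept R pm1))
  ... | yes pm1@(inj₁ _) | outside =
    trans (+-suc _ _) (trans (cong suc (lowerRoom+raiseRoom≡countPM1 R S)) (sym (countPM1-accept R pm1)))
  ... | yes pm1@(inj₂ _) | inside  =
    trans (+-suc _ _) (trans (cong suc (lowerRoom+raiseRoom≡countPM1 R S)) (sym (countPM1-accept R pm1)))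
  ... | yes pm1@(inj₂ _) | outside =
    trans (cong suc (lowerRoom+raiseRoom≡countPM1 R S)) (sym (countPM1-accept R pm1))
  ... | no ¬pm1 | _ = trans (lowerRoom+raiseRoom≡countPM1 R S) (sym (countPM1-reject R ¬pm1))

  lowerBy : ∀ R (S : Subset (length R)) d → d ≤ lowerRoom R S →
            Σ (Subset (length R)) λ S′ → subSum R S′ + d ≈ subSum R S
  lowerBy R S zero _ = S , ≡⇒≈ (+-identityʳ _)
  lowerBy [] [] (suc d) ()
  lowerBy (c ∷ R) (s ∷ S) (suc d) d<room with isPM1? k c | s
  ... | yes (inj₁ refl) | inside with lowerBy R S d (s≤s⁻¹ d<room)
  ...   | S′ , eq = outside ∷ S′ , trans (≡⇒≈ (+-suc _ d)) (≈-+ˡ 1 eq)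
  lowerBy (c ∷ R) (s ∷ S) (suc d) d<room | yes (inj₁ refl) | outside with lowerBy R S (suc d) d<room
  ...   | S′ , eq = outside ∷ S′ , eq
  lowerBy (c ∷ R) (s ∷ S) (suc d) d<room | yes (inj₂ refl) | inside with lowerBy R S (suc d) d<room
  ...   | S′ , eq = inside ∷ S′ , trans (≡⇒≈ (+-assoc c _ (suc d))) (≈-+ˡ c eq)
  lowerBy (c ∷ R) (s ∷ S) (suc d) d<room | yes (inj₂ refl) | outside with lowerBy R S d (s≤s⁻¹ d<room)
  ...   | S′ , eq = inside ∷ S′ , trans (∸1+suc≈ _ d) eq
  lowerBy (c ∷ R) (s ∷ S) (suc d) d<room | no _ | inside with lowerBy R S (suc d) d<room
  ...   | S′ , eq = inside ∷ S′ , trans (≡⇒≈ (+-assoc c _ (suc d))) (≈-+ˡ c eq)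
  lowerBy (c ∷ R) (s ∷ S) (suc d) d<room | no _ | outside with lowerBy R S (suc d) d<room
  ...   | S′ , eq = outside ∷ S′ , eq

  raiseBy : ∀ R (S : Subset (length R)) e → e ≤ raiseRoom R S →
            Σ (Subset (length R)) λ S′ → subSum R S′ ≈ subSum R S + e
  raiseBy R S zero _ = S , ≡⇒≈ (sym (+-identityʳ _))
  raiseBy [] [] (suc e) ()
  raiseBy (c ∷ R) (s ∷ S) (suc e) e<room with isPM1? k c | s
  ... | yes (inj₁ refl) | outside with raiseBy R S e (s≤s⁻¹ e<room)
  ...   | S′ , eq = inside ∷ S′ , trans (≈-+ˡ 1 eq) (≡⇒≈ (sym (+-suc _ e)))
  raiseBy (c ∷ R) (s ∷ S) (suc e) e<room | yes (inj₁ refl) | inside with raiseBy R S (suc e) e<room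
  ...   | S′ , eq = inside ∷ S′ , trans (≈-+ˡ 1 eq) (≡⇒≈ (sym (+-assoc 1 _ (suc e))))
  raiseBy (c ∷ R) (s ∷ S) (suc e) e<room | yes (inj₂ refl) | inside with raiseBy R S e (s≤s⁻¹ e<room)
  ...   | S′ , eq = outside ∷ S′ , trans eq (sym (∸1+suc≈ _ e))
  raiseBy (c ∷ R) (s ∷ S) (suc e) e<room | yes (inj₂ refl) | outside with raiseBy R S (suc e) e<room
  ...   | S′ , eq = outside ∷ S′ , eq
  raiseBy (c ∷ R) (s ∷ S) (suc e) e<room | no _ | inside with raiseBy R S (suc e) e<room
  ...   | S′ , eq = inside ∷ S′ , trans (≈-+ˡ c eq) (≡⇒≈ (sym (+-assoc c _ (suc e))))
  raiseBy (c ∷ R) (s ∷ S) (suc e) e<room | no _ | outside with raiseBy R S (suc e) e<room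
  ...   | S′ , eq = outside ∷ S′ , eq

module Type2Compression (k t : ℕ) (R : Collection) where
  open Congruence k

  a b : ℕ
  a = modK k (Mod k ∸ t)
  b = modK k (2 ^ k + (Mod k ∸ t))

  b≈a+H : b ≈ a + H
  b≈a+H = begin
    modK k b                    ≡⟨ modK≈ _ ⟩
    modK k (H + (Mod k ∸ t))    ≡⟨ ≡⇒≈ (+-comm H (Mod k ∸ t)) ⟩
    modK k ((Mod k ∸ t) + H)    ≡⟨ ≈-+ʳ H (modK≈ (Mod k ∸ t)) ⟨
    modK k (a + H)              ∎
    where open ≡-Reasoning

  b+b≈a+a : ∀ x → b + (b + x) ≈ a + (a + x)
  b+b≈a+a x = trans (≈-+ b≈a+H (≈-+ʳ x b≈a+H)) (trans (≡⇒≈ (shuffle a H x)) (+H+H≈ (a + (a + x))))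
    where
    shuffle : ∀ a h x → a + h + (a + h + x) ≡ a + (a + x) + h + h
    shuffle = solve-∀

  Original Compressed : Collection
  Original = a ∷ b ∷ b ∷ R
  Compressed = a ∷ a ∷ a ∷ R

  -- A sub-collection with j copies of a is matched by: j = 1 ↦ a, j = 2 ↦ b, b, j = 3 ↦ a, b, b.
  sumset-⊆ : ∀ (S : Subset (length Compressed)) →
             Σ (Subset (length Original)) λ S′ → subSum Original S′ ≈ subSum Compressed S
  sumset-⊆ (outside ∷ outside ∷ outside ∷ S) = outside ∷ outside ∷ outside ∷ S , refl
  sumset-⊆ (inside  ∷ outside ∷ outside ∷ S) = inside  ∷ outside ∷ outside ∷ S , refl
  sumset-⊆ (outside ∷ inside  ∷ outside ∷ S) = inside  ∷ outside ∷ outside ∷ S , refl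
  sumset-⊆ (outside ∷ outside ∷ inside  ∷ S) = inside  ∷ outside ∷ outside ∷ S , refl
  sumset-⊆ (inside  ∷ inside  ∷ outside ∷ S) = outside ∷ inside  ∷ inside  ∷ S , b+b≈a+a _
  sumset-⊆ (inside  ∷ outside ∷ inside  ∷ S) = outside ∷ inside  ∷ inside  ∷ S , b+b≈a+a _
  sumset-⊆ (outside ∷ inside  ∷ inside  ∷ S) = outside ∷ inside  ∷ inside  ∷ S , b+b≈a+a _
  sumset-⊆ (inside  ∷ inside  ∷ inside  ∷ S) = inside  ∷ inside  ∷ inside  ∷ S , ≈-+ˡ a (b+b≈a+a _)

  subSum-HalfShift : ∀ (S : Subset (length Compressed)) →
                     HalfShift (subSum Original S) (subSum Compressed S)
  subSum-HalfShift (s₁ ∷ s₂ ∷ s₃ ∷ S) =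
    HalfShift-∷ s₁ (inj₁ refl)
      (HalfShift-∷ s₂ (inj₂ b≈a+H) (HalfShift-∷ s₃ (inj₂ b≈a+H) (inj₁ refl)))

  DisjZeroSums-⊆ : ∀ {m} → HalfFree k Original → DisjZeroSums k Compressed m → DisjZeroSums k Original m
  DisjZeroSums-⊆ halfFree (F , nonempty , zero-sum , disjoint) =
    F , nonempty , (λ i → HalfShift-zero (subSum-HalfShift (F i)) (halfFree (F i)) (zero-sum i)) , disjoint

module Type3Compression (k u v : ℕ) (R : Collection) where
  open Congruence k
  open Rooms k

  Original Compressed : Collection
  Original = u ∷ v ∷ R
  Compressed = (u + 2 ^ k) ∷ (v + 2 ^ k) ∷ R

  ≈+H+H : ∀ x → HalfShift x (x + H)
  ≈+H+H x = inj₂ (sym (+H+H≈ x))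

  subSum-HalfShift : ∀ (S : Subset (length Compressed)) →
                     HalfShift (subSum Original S) (subSum Compressed S)
  subSum-HalfShift (s₁ ∷ s₂ ∷ S) =
    HalfShift-∷ s₁ (≈+H+H u) (HalfShift-∷ s₂ (≈+H+H v) (inj₁ refl))

  DisjZeroSums-⊆ : ∀ {m} → HalfFree k Original → DisjZeroSums k Compressed m → DisjZeroSums k Original m
  DisjZeroSums-⊆ halfFree (F , nonempty , zero-sum , disjoint) =
    F , nonempty , (λ i → HalfShift-zero (subSum-HalfShift (F i)) (halfFree (F i)) (zero-sum i)) , disjoint

  module _ (u+[H∸u] : u + (H ∸ u) ≡ H) (v+[H∸v] : v + (H ∸ v) ≡ H)
           (room : (H ∸ u) + (H ∸ v) ≤ countPM1 k R) where

    lowered : ∀ {x d s s′} → x + d ≡ H → s′ + d ≈ s → s′ ≈ x + H + s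
    lowered {x} {d} {s} {s′} x+d≡H s′+d≈s = sym (begin
      modK k (x + H + s)          ≡⟨ ≈-+ˡ (x + H) (sym s′+d≈s) ⟩
      modK k (x + H + (s′ + d))   ≡⟨ ≡⇒≈ (shuffle x H s′ d) ⟩
      modK k (s′ + (x + d) + H)   ≡⟨ ≡⇒≈ (cong (λ y → s′ + y + H) x+d≡H) ⟩
      modK k (s′ + H + H)         ≡⟨ +H+H≈ s′ ⟩
      modK k s′                   ∎)
      where
      open ≡-Reasoning
      shuffle : ∀ x h s d → x + h + (s + d) ≡ s + (x + d) + h
      shuffle = solve-∀

    raised : ∀ {x y e s s′} → y + e ≡ H → s′ ≈ s + e → x + (y + s′) ≈ x + H + s
    raised {x} {y} {e} {s} {s′} y+e≡H s′≈s+e = begin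
      modK k (x + (y + s′))       ≡⟨ ≈-+ˡ x (≈-+ˡ y s′≈s+e) ⟩
      modK k (x + (y + (s + e)))  ≡⟨ ≡⇒≈ (shuffle x y s e) ⟩
      modK k (x + (y + e) + s)    ≡⟨ ≡⇒≈ (cong (λ z → x + z + s) y+e≡H) ⟩
      modK k (x + H + s)          ∎
      where
      open ≡-Reasoning
      shuffle : ∀ x y s e → x + (y + (s + e)) ≡ x + (y + e) + s
      shuffle = solve-∀

    both : ∀ s → u + (v + s) ≈ u + H + (v + H + s)
    both s = sym (trans (≡⇒≈ (shuffle u v H s)) (+H+H≈ (u + (v + s))))
      where
      shuffle : ∀ u v h s → u + h + (v + h + s) ≡ u + (v + s) + h + h
      shuffle = solve-∀

    rooms : ∀ S → (H ∸ u) + (H ∸ v) ≤ lowerRoom R S + raiseRoom R S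
    rooms S = ≤-trans room (≤-reflexive (sym (lowerRoom+raiseRoom≡countPM1 R S)))

    -- Adding 2^k to u alone is undone either by lowering the rest by 2^k - u and dropping u,
    -- or by raising it by 2^k - v and adding v.
    sumset-⊆ : ∀ (S : Subset (length Compressed)) →
               Σ (Subset (length Original)) λ S′ → subSum Original S′ ≈ subSum Compressed S
    sumset-⊆ (outside ∷ outside ∷ S) = outside ∷ outside ∷ S , refl
    sumset-⊆ (inside ∷ inside ∷ S) = inside ∷ inside ∷ S , both (subSum R S)
    sumset-⊆ (inside ∷ outside ∷ S) with (H ∸ u) ≤? lowerRoom R S
    ... | yes fits with lowerBy R S (H ∸ u) fits
    ...   | S′ , eq = outside ∷ outside ∷ S′ , lowered u+[H∸u] eq
    sumset-⊆ (inside ∷ outside ∷ S) | no misfits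
      with raiseBy R S (H ∸ v) (m+n≤o+p⇒m≰o⇒n≤p (rooms S) misfits)
    ...   | S′ , eq = inside ∷ inside ∷ S′ , raised {x = u} v+[H∸v] eq
    sumset-⊆ (outside ∷ inside ∷ S) with (H ∸ v) ≤? lowerRoom R S
    ... | yes fits with lowerBy R S (H ∸ v) fits
    ...   | S′ , eq = outside ∷ outside ∷ S′ , lowered v+[H∸v] eq
    sumset-⊆ (outside ∷ inside ∷ S) | no misfits
      with raiseBy R S (H ∸ u)
             (m+n≤o+p⇒m≰o⇒n≤p (≤-trans (≤-reflexive (+-comm (H ∸ v) (H ∸ u))) (rooms S)) misfits)
    ...   | S′ , eq =
      inside ∷ inside ∷ S′ , trans (≡⇒≈ (x∙yz≈y∙xz u v _)) (raised {x = v} u+[H∸u] eq)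

module Type1Compression (k : ℕ) (R : Collection) (t a c : ℕ) where
  open Congruence k
  open Rooms k

  Copies Original Compressed : Collection
  Copies = replicate a c
  Original = t ∷ R
  Compressed = Copies ++ R

  subSum-Compressed : ∀ S → subSum Compressed S ≡ ∣ prefix Copies S ∣ * c + subSum R (suffix Copies S)
  subSum-Compressed S = trans (subSum-++ Copies S)
    (cong (_+ subSum R (suffix Copies S)) (subSum-replicate a c (prefix Copies S)))

  ∣prefix∣≤a : ∀ (S : Subset (length Compressed)) → ∣ prefix Copies S ∣ ≤ a
  ∣prefix∣≤a S = ≤-trans (∣p∣≤n (prefix Copies S)) (≤-reflexive (length-replicate a))

  module _ (a*c≈t : a * c ≈ t) where

    sumset-⊇ : ∀ (S : Subset (length Original)) →
               Σ (Subset (length Compressed)) λ S′ → subSum Compressed S′ ≈ subSum Original S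
    sumset-⊇ (outside ∷ S) = append Copies ⊥ S , ≡⇒≈ (begin
      subSum Compressed (append Copies ⊥ S)   ≡⟨ subSum-append Copies ⊥ S ⟩
      subSum Copies ⊥ + subSum R S            ≡⟨ cong (_+ subSum R S) (subSum-⊥ Copies) ⟩
      subSum R S                              ∎)
      where open ≡-Reasoning
    sumset-⊇ (inside ∷ S) = append Copies ⊤ S , (begin
      modK k (subSum Compressed (append Copies ⊤ S))  ≡⟨ ≡⇒≈ (subSum-append Copies ⊤ S) ⟩
      modK k (subSum Copies ⊤ + subSum R S)
        ≡⟨ ≡⇒≈ (cong (_+ subSum R S) (subSum-replicate a c ⊤)) ⟩
      modK k (∣ ⊤ {length Copies} ∣ * c + subSum R S)
        ≡⟨ ≡⇒≈ (cong (λ n → n * c + subSum R S) ∣⊤∣≡a) ⟩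
      modK k (a * c + subSum R S)                     ≡⟨ ≈-+ʳ (subSum R S) a*c≈t ⟩
      modK k (t + subSum R S)                         ∎)
      where
      open ≡-Reasoning
      ∣⊤∣≡a : ∣ ⊤ {length Copies} ∣ ≡ a
      ∣⊤∣≡a = trans (∣⊤∣≡n _) (length-replicate a)

    module _ (room : a ≤ suc (countPM1 k R)) where

      rooms : ∀ T → a ≤ suc (lowerRoom R T + raiseRoom R T)
      rooms T = ≤-trans room (≤-reflexive (cong suc (sym (lowerRoom+raiseRoom≡countPM1 R T))))

      rooms′ : ∀ T → a ≤ suc (raiseRoom R T + lowerRoom R T)
      rooms′ T = ≤-trans (rooms T) (≤-reflexive (cong suc (+-comm (lowerRoom R T) (raiseRoom R T))))

      -- j copies of 1 are realised by raising the rest by j, or else by taking t ≡ a and lowering by a - j.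
      reach-plus : c ≡ 1 → ∀ j T → j ≤ a →
                   Σ (Subset (length Original)) λ S′ → subSum Original S′ ≈ j * c + subSum R T
      reach-plus refl j T j≤a with j ≤? raiseRoom R T
      ... | yes fits with raiseBy R T j fits
      ...   | S′ , eq = outside ∷ S′ ,
        trans eq (≡⇒≈ (trans (+-comm (subSum R T) j) (cong (_+ subSum R T) (sym (*-identityʳ j)))))
      reach-plus refl j T j≤a | no misfits
        with lowerBy R T (a ∸ j) (m≤1+n+o⇒p≰o⇒m∸p≤n (rooms T) misfits)
      ...   | S′ , eq = inside ∷ S′ , (begin
        modK k (t + s′)              ≡⟨ ≈-+ʳ s′ (trans (sym a*c≈t) (≡⇒≈ (*-identityʳ a))) ⟩
        modK k (a + s′)              ≡⟨ ≡⇒≈ (cong (_+ s′) (sym (m+[n∸m]≡n j≤a))) ⟩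
        modK k (j + (a ∸ j) + s′)    ≡⟨ ≡⇒≈ (shuffle j (a ∸ j) s′) ⟩
        modK k (j + (s′ + (a ∸ j)))  ≡⟨ ≈-+ˡ j eq ⟩
        modK k (j + subSum R T)      ≡⟨ ≡⇒≈ (cong (_+ subSum R T) (*-identityʳ j)) ⟨
        modK k (j * 1 + subSum R T)  ∎)
        where
        open ≡-Reasoning
        s′ = subSum R S′
        shuffle : ∀ j g s → j + g + s ≡ j + (s + g)
        shuffle = solve-∀

      -- Dually for j copies of −1, with t ≡ −a.
      reach-minus : c ≡ Mod k ∸ 1 → ∀ j T → j ≤ a →
                    Σ (Subset (length Original)) λ S′ → subSum Original S′ ≈ j * c + subSum R T
      reach-minus refl j T j≤a with j ≤? lowerRoom R T
      ... | yes fits with lowerBy R T j fits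
      ...   | S′ , eq = outside ∷ S′ , sym (begin
        modK k (j * c + subSum R T)  ≡⟨ ≈-+ˡ (j * c) (sym eq) ⟩
        modK k (j * c + (s′ + j))    ≡⟨ ≡⇒≈ (x∙yz≈y∙xz (j * c) s′ j) ⟩
        modK k (s′ + (j * c + j))    ≡⟨ ≡⇒≈ (cong (s′ +_) (*[Mod∸1]+≡*Mod j)) ⟩
        modK k (s′ + j * Mod k)      ≡⟨ +*Mod≈ s′ j ⟩
        modK k s′                    ∎)
        where
        open ≡-Reasoning
        s′ = subSum R S′
      reach-minus refl j T j≤a | no misfits
        with raiseBy R T (a ∸ j) (m≤1+n+o⇒p≰o⇒m∸p≤n (rooms′ T) misfits)
      ...   | S′ , eq = inside ∷ S′ , (begin
        modK k (t + subSum R S′)      ≡⟨ ≈-+ (sym a*c≈t) eq ⟩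
        modK k (a * c + (s + g))      ≡⟨ ≡⇒≈ (cong (λ n → n * c + (s + g)) (sym (m+[n∸m]≡n j≤a))) ⟩
        modK k ((j + g) * c + (s + g)) ≡⟨ ≡⇒≈ (shuffle j g c s) ⟩
        modK k (j * c + s + (g * c + g)) ≡⟨ ≡⇒≈ (cong (j * c + s +_) (*[Mod∸1]+≡*Mod g)) ⟩
        modK k (j * c + s + g * Mod k) ≡⟨ +*Mod≈ (j * c + s) g ⟩
        modK k (j * c + s)            ∎)
        where
        open ≡-Reasoning
        s = subSum R T
        g = a ∸ j
        shuffle : ∀ j g c s → (j + g) * c + (s + g) ≡ j * c + s + (g * c + g)
        shuffle = solve-∀

      reach : IsPM1 k c → ∀ j T → j ≤ a →
              Σ (Subset (length Original)) λ S′ → subSum Original S′ ≈ j * c + subSum R T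
      reach (inj₁ c≡1) = reach-plus c≡1
      reach (inj₂ c≡-1) = reach-minus c≡-1

      sumset-⊆ : IsPM1 k c → ∀ (S : Subset (length Compressed)) →
                 Σ (Subset (length Original)) λ S′ → subSum Original S′ ≈ subSum Compressed S
      sumset-⊆ pm1 S with reach pm1 ∣ prefix Copies S ∣ (suffix Copies S) (∣prefix∣≤a S)
      ... | S′ , eq = S′ , trans eq (≡⇒≈ (sym (subSum-Compressed S)))

    Avoids : Subset (length Compressed) → Set
    Avoids S = ∣ prefix Copies S ∣ ≡ 0

    avoids? : ∀ S → Dec (Avoids S)
    avoids? S = ∣ prefix Copies S ∣ ≟ 0

    restrict : Subset (length Compressed) → Subset (length Original)
    restrict S = outside ∷ suffix Copies S

    merge : List (Subset (length Compressed)) → Subset (length Original)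
    merge Ts = inside ∷ suffix Copies (⋃ Ts)

    ZeroSum-restrict : ∀ {S} → Avoids S → ZeroSum k Compressed S → ZeroSum k Original (restrict S)
    ZeroSum-restrict {S} avoids (S≢⊥ , S≡0) = restrict≢⊥ , trans (cong (modK k) sum≡) S≡0
      where
      open ≡-Reasoning
      restrict≢⊥ : restrict S ≢ ⊥
      restrict≢⊥ restrict≡⊥ = S≢⊥ (begin
        S                                               ≡⟨ append-prefix-suffix Copies S ⟨
        append Copies (prefix Copies S) (suffix Copies S)
          ≡⟨ cong₂ (append Copies) (∣S∣≡0⇒S≡⊥ _ avoids) (proj₂ (∷-injective restrict≡⊥)) ⟩
        append Copies ⊥ ⊥                               ≡⟨ append-⊥ Copies ⟩
        ⊥                                               ∎)
      sum≡ : subSum R (suffix Copies S) ≡ subSum Compressed S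
      sum≡ = sym (trans (subSum-Compressed S) (cong (λ n → n * c + subSum R (suffix Copies S)) avoids))

    Disjoint-restrict : ∀ {S S′} → Disjoint S S′ → Disjoint (restrict S) (restrict S′)
    Disjoint-restrict S∩S′≡⊥ = cong (outside ∷_) (suffix-Disjoint Copies S∩S′≡⊥)

    ZeroSum-merge : ∀ Ts → ∣ prefix Copies (⋃ Ts) ∣ ≡ a → modK k (subSum Compressed (⋃ Ts)) ≡ 0 →
                    ZeroSum k Original (merge Ts)
    ZeroSum-merge Ts full ⋃Ts≡0 = (λ ()) , (begin
      modK k (t + s)                              ≡⟨ ≈-+ʳ s a*c≈t ⟨
      modK k (a * c + s)                          ≡⟨ ≡⇒≈ (cong (λ n → n * c + s) full) ⟨
      modK k (∣ prefix Copies (⋃ Ts) ∣ * c + s)   ≡⟨ ≡⇒≈ (subSum-Compressed (⋃ Ts)) ⟨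
      modK k (subSum Compressed (⋃ Ts))           ≡⟨ ⋃Ts≡0 ⟩
      0                                           ∎)
      where
      open ≡-Reasoning
      s = subSum R (suffix Copies (⋃ Ts))

    Disjoint-merge-restrict : ∀ {S Ts} → Disjoint S (⋃ Ts) → Disjoint (merge Ts) (restrict S)
    Disjoint-merge-restrict S∩⋃Ts≡⊥ =
      cong (outside ∷_) (suffix-Disjoint Copies (Disjoint-sym S∩⋃Ts≡⊥))

    length≤∣prefix-⋃∣ : ∀ {Ts} → AllPairs Disjoint Ts → All (λ S → ¬ Avoids S) Ts →
                        length Ts ≤ ∣ prefix Copies (⋃ Ts) ∣
    length≤∣prefix-⋃∣ {[]} _ _ = z≤n
    length≤∣prefix-⋃∣ {T ∷ Ts} (disjoint ∷ pairs) (meets ∷ meetss) = begin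
      suc (length Ts)
        ≤⟨ +-mono-≤ (n≢0⇒n>0 meets) (length≤∣prefix-⋃∣ pairs meetss) ⟩
      ∣ prefix Copies T ∣ + ∣ prefix Copies (⋃ Ts) ∣
        ≡⟨ ∣∪∣≡∣∣+∣∣ _ _ (prefix-Disjoint Copies (Disjoint-⋃ disjoint)) ⟨
      ∣ prefix Copies T ∪ prefix Copies (⋃ Ts) ∣
        ≡⟨ cong ∣_∣ (prefix-∪ Copies T (⋃ Ts)) ⟨
      ∣ prefix Copies (T ∪ ⋃ Ts) ∣
        ∎
      where open ≤-Reasoning

    packing-⊆ : ∀ {m L} → Packing k Compressed L → m + a ≤ suc (length L) →
                Σ (List (Subset (length Original))) λ L′ → m ≤ length L′ × Packing k Original L′
    packing-⊆ {m} {L} (zero-sums , pairs) m+a≤1+∣L∣ = finish (∣ prefix Copies (⋃ Meeting) ∣ ≟ a)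
      where
      Avoiding Meeting : List (Subset (length Compressed))
      Avoiding = filter avoids? L
      Meeting = filter (∁? avoids?) L

      Rest : List (Subset (length Original))
      Rest = map restrict Avoiding

      meetingPairs : AllPairs Disjoint Meeting
      meetingPairs = AllPairs.filter⁺ (∁? avoids?) pairs

      restPacking : Packing k Original Rest
      restPacking =
        All.map⁺ (All.zipWith (λ (avoids , zero-sum) → ZeroSum-restrict avoids zero-sum)
                              (All.all-filter avoids? L , All.filter⁺ avoids? zero-sums)) ,
        AllPairs.map⁺ (AllPairs.map Disjoint-restrict (AllPairs.filter⁺ avoids? pairs))

      ∣Meeting∣≤∣prefix∣ : length Meeting ≤ ∣ prefix Copies (⋃ Meeting) ∣
      ∣Meeting∣≤∣prefix∣ = length≤∣prefix-⋃∣ meetingPairs (All.all-filter (∁? avoids?) L)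

      m+a≤1+∣Rest∣+∣Meeting∣ : m + a ≤ suc (length Rest) + length Meeting
      m+a≤1+∣Rest∣+∣Meeting∣ = ≤-trans m+a≤1+∣L∣ (≤-reflexive (cong suc (begin
        length L                           ≡⟨ length-filter+length-filter-∁ avoids? L ⟨
        length Avoiding + length Meeting   ≡⟨ cong (_+ length Meeting) (length-map restrict Avoiding) ⟨
        length Rest + length Meeting       ∎)))
        where open ≡-Reasoning

      finish : Dec (∣ prefix Copies (⋃ Meeting) ∣ ≡ a) →
               Σ (List (Subset (length Original))) λ L′ → m ≤ length L′ × Packing k Original L′
      finish (yes full) =
        merge Meeting ∷ Rest ,
        m+n≤o+p⇒p≤n⇒m≤o m+a≤1+∣Rest∣+∣Meeting∣ (≤-trans ∣Meeting∣≤∣prefix∣ (≤-reflexive full)) ,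
        ZeroSum-merge Meeting full
          (modK-subSum-⋃ {k = k} {C = Compressed} meetingPairs (All.filter⁺ (∁? avoids?) zero-sums))
          ∷ proj₁ restPacking ,
        All.map⁺ (All.map (λ meetsNone → Disjoint-merge-restrict {Ts = Meeting} (Disjoint-⋃ meetsNone))
                          (AllPairs-filter-∁ avoids? Disjoint-sym pairs))
          ∷ proj₂ restPacking
      finish (no ¬full) =
        Rest ,
        m+n≤o+p⇒p≤n⇒m≤o (≤-trans m+a≤1+∣Rest∣+∣Meeting∣ (≤-reflexive (sym (+-suc _ _))))
          (≤-trans (s≤s ∣Meeting∣≤∣prefix∣) (≤∧≢⇒< (∣prefix∣≤a (⋃ Meeting)) ¬full)) ,
        restPacking

    DisjZeroSums-⊆ : ∀ {m} → DisjZeroSums k Compressed (m + a ∸ 1) → DisjZeroSums k Original m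
    DisjZeroSums-⊆ {m} zero-sums with DisjZeroSums⇒Packing {k = k} {C = Compressed} zero-sums
    ... | L , ∣L∣≡m+a-1 , packing
      with packing-⊆ packing (≤-trans (m≤n+m∸n (m + a) 1) (s≤s (≤-reflexive (sym ∣L∣≡m+a-1))))
    ... | L′ , m≤∣L′∣ , packing′ = Packing⇒DisjZeroSums {k = k} {C = Original} m≤∣L′∣ packing′

module CompressionFacts (k : ℕ) where
  open Congruence k
  open Rooms k

  ∈-head : ∀ {P : ℕ → Set} {C R t} → All P C → C ↭ (t ∷ R) → P t
  ∈-head all p = All.head (All-resp-↭ p all)

  Mod∸H≡H : Mod k ∸ H ≡ H
  Mod∸H≡H = trans (cong (_∸ H) Mod≡H+H) (m+n∸n≡m H H)

  1<absRes⇒¬IsPM1 : ∀ t → 1 < absRes k t → ¬ IsPM1 k t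
  1<absRes⇒¬IsPM1 t 1<∣t∣ (inj₁ refl) = <⇒≱ 1<∣t∣ (m⊓n≤m 1 _)
  1<absRes⇒¬IsPM1 t 1<∣t∣ (inj₂ refl) =
    <⇒≱ 1<∣t∣ (≤-trans (m⊓n≤n (Mod k ∸ 1) _) (≤-reflexive (m∸[m∸n]≡n 0<Mod)))

  absRes-low : ∀ t → t ≤ H ∸ 1 → absRes k t ≡ t
  absRes-low t t≤H-1 = m≤n⇒m⊓n≡m (begin
    t           ≤⟨ t≤H ⟩
    H           ≡⟨ Mod∸H≡H ⟨
    Mod k ∸ H   ≤⟨ ∸-monoʳ-≤ (Mod k) t≤H ⟩
    Mod k ∸ t   ∎)
    where
    open ≤-Reasoning
    t≤H = ≤-trans t≤H-1 (m∸n≤m H 1)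

  absRes-high : ∀ t → t < Mod k → t ≢ 0 → ¬ ((1 ≤ t) × (t ≤ H ∸ 1)) → t + absRes k t ≡ Mod k
  absRes-high t t<Mod t≢0 not-low =
    trans (cong (t +_) (m≥n⇒m⊓n≡n Mod∸t≤t)) (m+[n∸m]≡n (<⇒≤ t<Mod))
    where
    H≤t : H ≤ t
    H≤t with t ≤? H ∸ 1
    ... | yes t≤H-1 = ⊥-elim (not-low (n≢0⇒n>0 t≢0 , t≤H-1))
    ... | no t≰H-1 = ≤-trans (≤-reflexive (sym (m+[n∸m]≡n {1} 0<H))) (≰⇒> t≰H-1)
    Mod∸t≤t : Mod k ∸ t ≤ t
    Mod∸t≤t = ≤-trans (∸-monoʳ-≤ (Mod k) H≤t) (≤-trans (≤-reflexive Mod∸H≡H) H≤t)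

  *[Mod∸1]≈ : ∀ {t a} → t + a ≡ Mod k → a * (Mod k ∸ 1) ≈ t
  *[Mod∸1]≈ {t} {a} t+a≡Mod = begin
    modK k (a * (Mod k ∸ 1))            ≡⟨ +Mod≈ _ ⟨
    modK k (a * (Mod k ∸ 1) + Mod k)    ≡⟨ ≡⇒≈ (+-cancelʳ-≡ a _ _ (begin
      a * (Mod k ∸ 1) + Mod k + a         ≡⟨ shuffle (a * (Mod k ∸ 1)) (Mod k) a ⟩
      a * (Mod k ∸ 1) + a + Mod k         ≡⟨ cong₂ _+_ (*[Mod∸1]+≡*Mod a) (sym t+a≡Mod) ⟩
      a * Mod k + (t + a)                 ≡⟨ shuffle′ (a * Mod k) t a ⟩
      t + a * Mod k + a                   ∎)) ⟩
    modK k (t + a * Mod k)              ≡⟨ +*Mod≈ t a ⟩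
    modK k t                            ∎
    where
    open ≡-Reasoning
    shuffle : ∀ x m a → x + m + a ≡ x + a + m
    shuffle = solve-∀
    shuffle′ : ∀ y t a → y + (t + a) ≡ t + y + a
    shuffle′ = solve-∀

  ¬IsPM1-upper : ∀ u → 3 ≤ 2 * u → u ≤ H ∸ 1 → ¬ IsPM1 k u
  ¬IsPM1-upper u 3≤2u _ (inj₁ refl) = <⇒≱ (s≤s (s≤s (s≤s z≤n))) 3≤2u
  ¬IsPM1-upper u _ u≤H-1 (inj₂ refl) = <⇒≱ H<Mod (begin
    Mod k           ≡⟨ m+[n∸m]≡n 0<Mod ⟨
    suc (Mod k ∸ 1) ≤⟨ s≤s u≤H-1 ⟩
    suc (H ∸ 1)     ≡⟨ m+[n∸m]≡n 0<H ⟩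
    H               ∎)
    where open ≤-Reasoning

  countPM1-drop : ∀ {C R t} → C ↭ (t ∷ R) → ¬ IsPM1 k t → countPM1 k C ≡ countPM1 k R
  countPM1-drop p ¬pm1 = trans (countPM1-↭ p) (countPM1-reject _ ¬pm1)

  type1-room : ∀ {C R t λ′} → C ↭ (t ∷ R) → 1 < absRes k t → absRes k t ≤ λ′ + 1 →
               λ′ ≤ countPM1 k C → absRes k t ≤ suc (countPM1 k R)
  type1-room {C} {R} {t} {λ′} p 1<∣t∣ ∣t∣≤λ′+1 λ′≤count = begin
    absRes k t            ≤⟨ ∣t∣≤λ′+1 ⟩
    λ′ + 1                ≡⟨ +-comm λ′ 1 ⟩
    suc λ′                ≤⟨ s≤s λ′≤count ⟩
    suc (countPM1 k C)    ≡⟨ cong suc (countPM1-drop p (1<absRes⇒¬IsPM1 t 1<∣t∣)) ⟩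
    suc (countPM1 k R)    ∎
    where open ≤-Reasoning

record Type1View (k : ℕ) (C : Collection) (t : ℕ) (C′ : Collection) : Set where
  field
    rest : Collection
    unit : ℕ
    original : C ↭ (t ∷ rest)
    compressed : C′ ↭ (replicate (absRes k t) unit ++ rest)
    isPM1 : IsPM1 k unit
    copies≈t : modK k (absRes k t * unit) ≡ modK k t
    room : absRes k t ≤ suc (countPM1 k rest)

type1View : ∀ {k C t C′} → All (λ c → c < Mod k) C → All (λ c → c ≢ 0) C →
            Type1 k C t C′ → Type1View k C t C′
type1View {k} {t = t} _ _
          (λ′ , _ , λ′≤count , 1<∣t∣ , ∣t∣≤λ′+1 , R , p , inj₁ (_ , t≤H-1 , q)) = record
  { rest = R ; unit = 1 ; original = p ; compressed = q ; isPM1 = inj₁ refl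
  ; copies≈t = cong (modK k) (trans (*-identityʳ _) (absRes-low t t≤H-1))
  ; room = type1-room p 1<∣t∣ ∣t∣≤λ′+1 λ′≤count
  }
  where open CompressionFacts k
type1View {k} {t = t} <Mod ≢0
          (λ′ , _ , λ′≤count , 1<∣t∣ , ∣t∣≤λ′+1 , R , p , inj₂ (not-low , q)) = record
  { rest = R ; unit = Mod k ∸ 1 ; original = p ; compressed = q ; isPM1 = inj₂ refl
  ; copies≈t = *[Mod∸1]≈ (absRes-high t (∈-head <Mod p) (∈-head ≢0 p) not-low)
  ; room = type1-room p 1<∣t∣ ∣t∣≤λ′+1 λ′≤count
  }
  where open CompressionFacts k

module _ {k : ℕ} {C : Collection} where
  open CompressionFacts k

  type1-sumset : All (λ c → c < Mod k) C → All (λ c → c ≢ 0) C →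
                 ∀ {t C′} → Type1 k C t C′ → ∀ x → InSumset k C′ x ⇔ InSumset k C x
  type1-sumset <Mod ≢0 {t} compression x = mk⇔
    (InSumset-⊆ k original compressed (sumset-⊆ copies≈t room isPM1))
    (InSumset-⊆ k compressed original (sumset-⊇ copies≈t))
    where
    open Type1View (type1View {k} <Mod ≢0 compression)
    open Type1Compression k rest t (absRes k t) unit

  type1-DisjZeroSums : All (λ c → c < Mod k) C → All (λ c → c ≢ 0) C →
                       ∀ {t C′ m} → Type1 k C t C′ → DisjZeroSums k C′ (m + absRes k t ∸ 1) →
                       DisjZeroSums k C m
  type1-DisjZeroSums <Mod ≢0 {t} compression zero-sums = DisjZeroSums-resp-↭ k (↭-sym original)
    (DisjZeroSums-⊆ copies≈t (DisjZeroSums-resp-↭ k compressed zero-sums))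
    where
    open Type1View (type1View {k} <Mod ≢0 compression)
    open Type1Compression k rest t (absRes k t) unit

  type2-sumset : ∀ {C′} → Type2 k C C′ → ∀ x → InSumset k C′ x → InSumset k C x
  type2-sumset (t , _ , R , p , q) x = InSumset-⊆ k p q sumset-⊆
    where open Type2Compression k t R

  type2-DisjZeroSums : HalfFree k C → ∀ {C′ m} → Type2 k C C′ →
                       DisjZeroSums k C′ m → DisjZeroSums k C m
  type2-DisjZeroSums halfFree (t , _ , R , p , q) zero-sums = DisjZeroSums-resp-↭ k (↭-sym p)
    (DisjZeroSums-⊆ (HalfFree-resp-↭ k p halfFree) (DisjZeroSums-resp-↭ k q zero-sums))
    where open Type2Compression k t R

  type3-DisjZeroSums : HalfFree k C → ∀ {C′ m} → Type3 k C C′ →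
                       DisjZeroSums k C′ m → DisjZeroSums k C m
  type3-DisjZeroSums halfFree (_ , u , v , _ , _ , _ , _ , R , p , q) zero-sums =
    DisjZeroSums-resp-↭ k (↭-sym p) (DisjZeroSums-⊆ (HalfFree-resp-↭ k p halfFree) (DisjZeroSums-resp-↭ k q zero-sums))
    where open Type3Compression k u v R

type3-room : ∀ j {C R u v} → C ↭ (u ∷ v ∷ R) → 2 ^ j ≤ countPM1 (suc j) C →
             3 * 2 ^ j ≤ 2 * u → u ≤ 2 ^ suc j ∸ 1 → 3 * 2 ^ j ≤ 2 * v → v ≤ 2 ^ suc j ∸ 1 →
             (2 ^ suc j ∸ u) + (2 ^ suc j ∸ v) ≤ countPM1 (suc j) R
type3-room j {C} {R} {u} {v} p count 3P≤2u u≤H-1 3P≤2v v≤H-1 = *-cancelˡ-≤ 2 (begin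
  2 * ((H ∸ u) + (H ∸ v))       ≡⟨ *-distribˡ-+ 2 (H ∸ u) (H ∸ v) ⟩
  2 * (H ∸ u) + 2 * (H ∸ v)     ≤⟨ +-mono-≤ (2*[2P∸u]≤P P u 3P≤2u) (2*[2P∸u]≤P P v 3P≤2v) ⟩
  P + P                         ≤⟨ +-mono-≤ count count ⟩
  countPM1 k C + countPM1 k C   ≡⟨ cong (λ n → n + n) countPM1-C≡countPM1-R ⟩
  countPM1 k R + countPM1 k R   ≡⟨ cong (countPM1 k R +_) (+-identityʳ _) ⟨
  2 * countPM1 k R              ∎)
  where
  open ≤-Reasoning
  k = suc j
  P = 2 ^ j
  open Congruence k
  open Rooms k
  open CompressionFacts k
  3≤2* : ∀ {u} → 3 * P ≤ 2 * u → 3 ≤ 2 * u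
  3≤2* = ≤-trans (*-monoʳ-≤ 3 (m^n>0 2 j))
  countPM1-C≡countPM1-R : countPM1 k C ≡ countPM1 k R
  countPM1-C≡countPM1-R = trans (countPM1-drop p (¬IsPM1-upper u (3≤2* {u} 3P≤2u) u≤H-1))
                                (countPM1-reject R (¬IsPM1-upper v (3≤2* {v} 3P≤2v) v≤H-1))

type3-sumset : ∀ {j C C′} → Type3 (suc j) C C′ → ∀ x → InSumset (suc j) C′ x → InSumset (suc j) C x
type3-sumset {j} (count , u , v , 3P≤2u , u≤H-1 , 3P≤2v , v≤H-1 , R , p , q) x =
  InSumset-⊆ k p q
    (sumset-⊆ (u+[H∸u] u≤H-1) (u+[H∸u] v≤H-1) (type3-room j p count 3P≤2u u≤H-1 3P≤2v v≤H-1))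
  where
  k = suc j
  open Congruence k
  open Type3Compression k u v R
  u+[H∸u] : ∀ {u} → u ≤ H ∸ 1 → u + (H ∸ u) ≡ H
  u+[H∸u] u≤H-1 = m+[n∸m]≡n (≤-trans u≤H-1 (m∸n≤m H 1))

lemma3p5 : (k : ℕ) → 1 ≤ k → (C : Collection) →
    All (λ c → c < Mod k) C → All (λ c → c ≢ 0) C →
    (∀ (S : Subset (length C)) → modK k (subSum C S) ≢ 2 ^ k) →
    (∀ t C' → Type1 k C t C' → ∀ x → InSumset k C' x ⇔ InSumset k C x) ×
    (∀ C' → Type2 k C C' → ∀ x → InSumset k C' x → InSumset k C x) ×
    (∀ C' → Type3 k C C' → ∀ x → InSumset k C' x → InSumset k C x) ×
    (∀ C' m → Type2 k C C' ⊎ Type3 k C C' → DisjZeroSums k C' m → DisjZeroSums k C m) ×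
    (∀ t C' m → Type1 k C t C' → DisjZeroSums k C' (m + absRes k t ∸ 1) → DisjZeroSums k C m)
lemma3p5 k@(suc j) _ C <Mod ≢0 halfFree =
  (λ t C′ → type1-sumset {k} <Mod ≢0) ,
  (λ C′ → type2-sumset {k}) ,
  (λ C′ → type3-sumset {j}) ,
  (λ { C′ m (inj₁ compression) → type2-DisjZeroSums {k} halfFree compression
     ; C′ m (inj₂ compression) → type3-DisjZeroSums {k} halfFree compression }) ,
  (λ t C′ m → type1-DisjZeroSums {k} <Mod ≢0)
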